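{- There exist absolute constants $C,c>0$ such that the following holds. Let $q$ be a prime power with $q\equiv 3 \pmod 4$ and let $E\subset\mathbb{F}_q^2$ with $|E|\ge Cq$. Then for every nonzero square $r\in\mathbb{F}_q$, the number of quadruples $(a,b,c,d)\in E^4$ with $\|c-d\|\neq 0$ and $\|a-b\|/\|c-d\|=r$ is at least $c\,|E|^4q^{ -1}$. In particular, \[(\mathbb{F}_q)^2\subseteq \frac{\Delta(E)}{\Delta(E)}.\]
   Context: $\mathbb{F}_q$ is the finite field with $q$ elements and $(\mathbb{F}_q)^2=\{t^2\colon t\in\mathbb{F}_q\}$ is the set of squares in $\mathbb{F}_q$. For $x=(x_1,x_2)\in\mathbb{F}_q^2$, $\|x\|=x_1^2+x_2^2$. $\Delta(E)=\{\|x-y\|\colon x,y\in E\}$ and $\frac{\Delta(E)}{\Delta(E)}=\{a/b\colon a,b\in\Delta(E),\ b\neq 0\}$. The paper's hypothesis "$|E|\gg q$" and conclusion "$\gg |E|^4q^{ -1}$" are rendered with explicit absolute constants. -}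

module Defs where

open import Data.Nat as ℕ using (ℕ; _^_; _%_)
open import Data.Nat.Primality using (Prime)
open import Data.Product using (_×_; _,_; ∃; ∃-syntax)
open import Data.List using (List; length; filter; cartesianProduct; map)
open import Data.List.Membership.Propositional using (_∈_)
open import Data.List.Relation.Unary.Unique.Propositional using (Unique)
open import Relation.Binary.PropositionalEquality using (_≡_; _≢_)
open import Relation.Binary.Definitions using (DecidableEquality)
open import Relation.Nullary using (Dec; ¬?)
open import Relation.Nullary.Decidable using (_×-dec_)
open import Algebra.Core using (Op₁; Op₂)
open import Algebra.Structures using (IsCommutativeRing)

record FiniteField : Set₁ where
  infixl 6 _+_
  infixl 7 _*_
  field
    Carrier : Set
    _+_ _*_ : Op₂ Carrier
    -_ : Op₁ Carrier
    0# 1# : Carrier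
    isCommutativeRing : IsCommutativeRing _≡_ _+_ _*_ -_ 0# 1#
    0≢1 : 0# ≢ 1#
    _⁻¹ : Op₁ Carrier
    ⁻¹-inverse : ∀ x → x ≢ 0# → x * (x ⁻¹) ≡ 1#
    _≟_ : DecidableEquality Carrier
    elements : List Carrier
    elements-unique : Unique elements
    elements-complete : ∀ x → x ∈ elements

  size : ℕ
  size = length elements

module _ (F : FiniteField) where
  open FiniteField F

  infixl 6 _-_
  infixl 7 _/_
  _-_ : Op₂ Carrier
  x - y = x + (- y)

  _/_ : Op₂ Carrier
  x / y = x * (y ⁻¹)

  Point : Set
  Point = Carrier × Carrier

  _-ᵖ_ : Point → Point → Point
  (x₁ , x₂) -ᵖ (y₁ , y₂) = (x₁ - y₁ , x₂ - y₂)

  ‖_‖ : Point → Carrier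
  ‖ (x₁ , x₂) ‖ = x₁ * x₁ + x₂ * x₂

  IsSquare : Carrier → Set
  IsSquare r = ∃[ t ] (t * t ≡ r)

  GoodQuad : Carrier → Point × Point × Point × Point → Set
  GoodQuad r (a , b , c , d) = (‖ c -ᵖ d ‖ ≢ 0#) × ((‖ a -ᵖ b ‖ / ‖ c -ᵖ d ‖) ≡ r)

  goodQuad? : (r : Carrier) → (t : Point × Point × Point × Point) → Dec (GoodQuad r t)
  goodQuad? r (a , b , c , d) =
    ¬? (‖ c -ᵖ d ‖ ≟ 0#) ×-dec ((‖ a -ᵖ b ‖ / ‖ c -ᵖ d ‖) ≟ r)

  -- E^4 as a list (E given as a duplicate-free list of points)
  quadruples : List Point → List (Point × Point × Point × Point)
  quadruples E = cartesianProduct E (cartesianProduct E (cartesianProduct E E))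

  countQuads : List Point → Carrier → ℕ
  countQuads E r = length (filter (goodQuad? r) (quadruples E))

  InDistanceQuotient : List Point → Carrier → Set
  InDistanceQuotient E r =
    ∃[ a ] ∃[ b ] ∃[ c ] ∃[ d ]
      (a ∈ E × b ∈ E × c ∈ E × d ∈ E × GoodQuad r (a , b , c , d))

IsPrimePower : ℕ → Set
IsPrimePower q = ∃[ p ] ∃[ k ] (Prime p × 1 ℕ.≤ k × q ≡ p ^ k)

{-# OPTIONS --safe #-}
module Submission where

-- Since q ≡ 3 (mod 4), 1 + 1 ≠ 0 (else x ↦ x + 1 pairs up the elements of F_q and q is even)
-- and −1 is not a square in F_q (a square root i of −1 would make x ↦ i x act freely on F_q^*
-- with orbits of size 4, forcing 4 ∣ q − 1).  Hence ‖x‖ = x₁² + x₂² is the norm of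
-- F_q[i] ≅ F_{q²}: it vanishes only at 0 and is multiplicative for (a, b)·(c, d) = (ac − bd, ad + bc).
-- Fix r = s² ≠ 0.  The points λ_t = s·((1 − t²)/(1 + t²), 2t/(1 + t²)), t ∈ F_q, are q distinct
-- points of norm r.  For each t, the map h_t(a, c) = a − λ_t·c on E × E has, by Cauchy–Schwarz,
-- at least |E|⁴/q² collisions.  The |E|² collisions with c = d are trivial (they force a = b);
-- a collision with c ≠ d gives a − b = λ_t·(c − d), so ‖a − b‖/‖c − d‖ = r, and the quadruple
-- determines λ_t and hence t.  Summing over t,
-- q·|E|⁴/q² ≤ #{(a,b,c,d) : ‖a − b‖/‖c − d‖ = r} + q·|E|², and |E| ≥ 2q absorbs the error term.
-- The square 0 is ‖a − a‖/‖a − b‖ for any two distinct points a, b of E.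

open import Defs renaming (‖_‖ to norm; _-ᵖ_ to diffᵖ)
open import Level using (0ℓ)
open import Function using (_∘_)
open import Data.Nat as ℕ using (ℕ; zero; suc; pred; _%_; NonZero)
import Data.Nat.Properties as ℕ
open import Data.Nat.Divisibility using (_∣_; divides; n∣m⇒m%n≡0)
open import Data.Nat.DivMod using (m∣n⇒o%n%m≡o%m; %-remove-+ʳ)
open import Data.Nat.Tactic.RingSolver using (solve-∀)
open import Data.Integer as ℤ using (ℤ; _⊖_)
import Data.Integer.Properties as ℤ
open import Agda.Builtin.Int using (pos; negsuc)
open import Data.Maybe using (Maybe; just; nothing)
open import Data.List as List using (List; []; _∷_; length; filter; map; _++_; cartesianProduct)
import Data.List.Properties as List
open import Data.List.Membership.Propositional using (_∈_; find)
open import Data.List.Membership.Propositional.Properties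
  using (∈-filter⁻; ∈-filter⁺; ∈-cartesianProduct⁺; ∈-cartesianProduct⁻)
open import Data.List.Relation.Unary.Any using (Any; here; there)
open import Data.List.Relation.Unary.All as All using (All; []; _∷_)
open import Data.List.Relation.Unary.AllPairs using ([]; _∷_)
open import Data.List.Relation.Unary.Unique.Propositional using (Unique)
import Data.List.Relation.Unary.Unique.Propositional.Properties as Unique
open import Data.Product using (_×_; _,_; proj₁; proj₂; ∃-syntax)
open import Data.Product.Properties using (≡-dec)
open import Data.Sum using (_⊎_; inj₁; inj₂)
open import Algebra.Bundles using (CommutativeRing)
open import Algebra.Solver.Ring.AlmostCommutativeRing using (_-Raw-AlmostCommutative⟶_; fromCommutativeRing)
open import Relation.Nullary using (¬_; Dec; yes; no; ¬?; contradiction)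
open import Relation.Nullary.Decidable using (_×-dec_)
open import Relation.Unary using (Pred; Decidable)
open import Relation.Unary.Properties using (∁?)
open import Relation.Binary.Definitions using (DecidableEquality)
open import Relation.Binary.PropositionalEquality

module Arithmetic where
  open import Data.Nat using (_+_; _*_; _^_; _≤_)
  open import Data.Nat.Properties
    using (≤-trans; ≤-reflexive; ≤-total; +-mono-≤; +-monoʳ-≤; *-monoˡ-≤; *-monoʳ-≤; *-mono-≤; *-cancelˡ-≤;
           +-cancelʳ-≤; +-identityʳ; *-assoc; *-distribˡ-+; m≤m+n; m≤n⇒∃[o]m+o≡n; module ≤-Reasoning)
  open ≤-Reasoning

  2xy≤x²+y² : ∀ x y → 2 * x * y ≤ x * x + y * y
  2xy≤x²+y² x y with ≤-total x y
  ... | inj₁ x≤y with k , refl ← m≤n⇒∃[o]m+o≡n x≤y =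
    subst (2 * x * (x + k) ≤_) (identity x k) (m≤m+n _ (k * k))
    where
    identity : ∀ x k → 2 * x * (x + k) + k * k ≡ x * x + (x + k) * (x + k)
    identity = solve-∀
  ... | inj₂ y≤x with k , refl ← m≤n⇒∃[o]m+o≡n y≤x =
    subst (2 * (y + k) * y ≤_) (identity y k) (m≤m+n _ (k * k))
    where
    identity : ∀ y k → 2 * (y + k) * y + k * k ≡ (y + k) * (y + k) + y * y
    identity = solve-∀

  -- The inductive step of Cauchy–Schwarz (m₁ + ⋯ + m_k)² ≤ k (m₁² + ⋯ + m_k²), adding one more term a.
  [a+b]²≤[1+M][a²+c] : ∀ a b M c → b * b ≤ M * c → (a + b) * (a + b) ≤ suc M * (a * a + c)
  [a+b]²≤[1+M][a²+c] a zero M c _ = ≤-trans (≤-reflexive (+0² a)) (≤-trans (m≤m+n (a * a) c) (m≤m+n _ _))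
    where
    +0² : ∀ a → (a + 0) * (a + 0) ≡ a * a
    +0² = solve-∀
  [a+b]²≤[1+M][a²+c] a (suc b) zero c ()
  [a+b]²≤[1+M][a²+c] a b M@(suc _) c b²≤Mc = begin
    (a + b) * (a + b)                  ≡⟨ expand a b ⟩
    a * a + b * b + 2 * a * b          ≤⟨ +-mono-≤ (+-monoʳ-≤ (a * a) b²≤Mc) 2ab≤Ma²+c ⟩
    a * a + M * c + (M * (a * a) + c)  ≡⟨ collect a M c ⟨
    suc M * (a * a + c)                ∎
    where
    expand : ∀ a b → (a + b) * (a + b) ≡ a * a + b * b + 2 * a * b
    expand = solve-∀
    collect : ∀ a M c → suc M * (a * a + c) ≡ a * a + M * c + (M * (a * a) + c)
    collect = solve-∀
    M[2ab]≡2[Ma]b : ∀ M a b → M * (2 * a * b) ≡ 2 * (M * a) * b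
    M[2ab]≡2[Ma]b = solve-∀
    M[Ma²+c] : ∀ M a c → M * a * (M * a) + M * c ≡ M * (M * (a * a) + c)
    M[Ma²+c] = solve-∀
    2ab≤Ma²+c : 2 * a * b ≤ M * (a * a) + c
    2ab≤Ma²+c = *-cancelˡ-≤ M (begin
      M * (2 * a * b)          ≡⟨ M[2ab]≡2[Ma]b M a b ⟩
      2 * (M * a) * b          ≤⟨ 2xy≤x²+y² (M * a) b ⟩
      M * a * (M * a) + b * b  ≤⟨ +-monoʳ-≤ (M * a * (M * a)) b²≤Mc ⟩
      M * a * (M * a) + M * c  ≡⟨ M[Ma²+c] M a c ⟩
      M * (M * (a * a) + c)    ∎)

  x≤y+z∧2z≤x⇒x≤2y : ∀ {x y z} → x ≤ y + z → 2 * z ≤ x → x ≤ 2 * y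
  x≤y+z∧2z≤x⇒x≤2y {x} {y} {z} x≤y+z 2z≤x = +-cancelʳ-≤ x x (2 * y) (begin
    x + x          ≡⟨ cong (x +_) (+-identityʳ x) ⟨
    2 * x          ≤⟨ *-monoʳ-≤ 2 x≤y+z ⟩
    2 * (y + z)    ≡⟨ *-distribˡ-+ 2 y z ⟩
    2 * y + 2 * z  ≤⟨ +-monoʳ-≤ (2 * y) 2z≤x ⟩
    2 * y + x      ∎)

  n⁴≤q[G+qn²]⇒n⁴≤2qG : ∀ n q G → 2 * q ≤ n → (n * n) * (n * n) ≤ q * (G + q * (n * n)) → n ^ 4 ≤ 2 * q * G
  n⁴≤q[G+qn²]⇒n⁴≤2qG n q G 2q≤n n⁴≤q[G+qn²] = begin
    n ^ 4              ≡⟨ n⁴≡n²n² n ⟩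
    (n * n) * (n * n)  ≤⟨ x≤y+z∧2z≤x⇒x≤2y {y = q * G} n⁴≤qG+q²n² 2q²n²≤n⁴ ⟩
    2 * (q * G)        ≡⟨ *-assoc 2 q G ⟨
    2 * q * G          ∎
    where
    n⁴≤qG+q²n² : (n * n) * (n * n) ≤ q * G + q * (q * (n * n))
    n⁴≤qG+q²n² = ≤-trans n⁴≤q[G+qn²] (≤-reflexive (*-distribˡ-+ q G (q * (n * n))))
    n⁴≡n²n² : ∀ n → n * (n * (n * (n * 1))) ≡ (n * n) * (n * n)
    n⁴≡n²n² = solve-∀
    [2q]²n² : ∀ q n → 2 * (q * (q * (n * n))) + 2 * (q * (q * (n * n))) ≡ (2 * q) * (2 * q) * (n * n)
    [2q]²n² = solve-∀
    2q²n²≤n⁴ : 2 * (q * (q * (n * n))) ≤ (n * n) * (n * n)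
    2q²n²≤n⁴ = begin
      2 * (q * (q * (n * n)))                            ≤⟨ m≤m+n _ _ ⟩
      2 * (q * (q * (n * n))) + 2 * (q * (q * (n * n)))  ≡⟨ [2q]²n² q n ⟩
      (2 * q) * (2 * q) * (n * n)                        ≤⟨ *-monoˡ-≤ (n * n) (*-mono-≤ 2q≤n 2q≤n) ⟩
      (n * n) * (n * n)                                  ∎

open Arithmetic

module FiniteSums where
  open import Data.Nat using (_+_; _*_; _≤_; _<_; z≤n; s≤s)
  open import Data.Nat.Properties
    using (≤-trans; ≤-reflexive; ≤-antisym; +-mono-≤; m≤m+n; m≤n+m; *-identityʳ; *-zeroʳ; *-distribˡ-+; +-assoc;
           +-commutativeSemigroup)
  open import Data.Nat.ListAction using (sum)
  open import Data.Nat.ListAction.Properties using (sum-++)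
  open import Algebra.Properties.CommutativeSemigroup +-commutativeSemigroup using (interchange; x∙yz≈y∙xz)
  open ≡-Reasoning

  𝟙 : ∀ {p} {P : Set p} → Dec P → ℕ
  𝟙 (yes _) = 1
  𝟙 (no _) = 0

  𝟙-yes : ∀ {p} {P : Set p} (P? : Dec P) → P → 𝟙 P? ≡ 1
  𝟙-yes (yes _) _ = refl
  𝟙-yes (no ¬p) p = contradiction p ¬p

  𝟙-no : ∀ {p} {P : Set p} (P? : Dec P) → ¬ P → 𝟙 P? ≡ 0
  𝟙-no (yes p) ¬p = contradiction p ¬p
  𝟙-no (no _) _ = refl

  𝟙-⊎ : ∀ {p q r} {P : Set p} {Q : Set q} {R : Set r} (P? : Dec P) (Q? : Dec Q) (R? : Dec R) →
        (P → Q ⊎ R) → 𝟙 P? ≤ 𝟙 Q? + 𝟙 R?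
  𝟙-⊎ (no _) _ _ _ = z≤n
  𝟙-⊎ (yes p) Q? R? P⇒Q⊎R with P⇒Q⊎R p
  ... | inj₁ q = ≤-trans (≤-reflexive (sym (𝟙-yes Q? q))) (m≤m+n _ _)
  ... | inj₂ r = ≤-trans (≤-reflexive (sym (𝟙-yes R? r))) (m≤n+m _ _)

  module _ {a} {A : Set a} where

    ∑ : List A → (A → ℕ) → ℕ
    ∑ xs f = sum (map f xs)

    syntax ∑ xs (λ x → e) = ∑[ x ∈ xs ] e

    ∑-cong : ∀ xs {f g : A → ℕ} → (∀ {x} → x ∈ xs → f x ≡ g x) → ∑ xs f ≡ ∑ xs g
    ∑-cong [] _ = refl
    ∑-cong (x ∷ xs) f≡g = cong₂ _+_ (f≡g (here refl)) (∑-cong xs (f≡g ∘ there))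

    ∑-mono : ∀ xs {f g : A → ℕ} → (∀ {x} → x ∈ xs → f x ≤ g x) → ∑ xs f ≤ ∑ xs g
    ∑-mono [] _ = z≤n
    ∑-mono (x ∷ xs) f≤g = +-mono-≤ (f≤g (here refl)) (∑-mono xs (λ x∈xs → f≤g (there x∈xs)))

    ∑-+ : ∀ xs (f g : A → ℕ) → ∑[ x ∈ xs ] (f x + g x) ≡ ∑ xs f + ∑ xs g
    ∑-+ [] f g = refl
    ∑-+ (x ∷ xs) f g =
      trans (cong (f x + g x +_) (∑-+ xs f g)) (interchange (f x) (g x) (∑ xs f) (∑ xs g))

    ∑-const : ∀ xs k → ∑[ _ ∈ xs ] k ≡ length xs * k
    ∑-const [] k = refl
    ∑-const (x ∷ xs) k = cong (k +_) (∑-const xs k)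

    length≡∑1 : ∀ xs → length xs ≡ ∑[ _ ∈ xs ] 1
    length≡∑1 xs = sym (trans (∑-const xs 1) (*-identityʳ _))

    ∑-*ˡ : ∀ xs k (f : A → ℕ) → ∑[ x ∈ xs ] (k * f x) ≡ k * ∑ xs f
    ∑-*ˡ [] k f = sym (*-zeroʳ k)
    ∑-*ˡ (x ∷ xs) k f = trans (cong (k * f x +_) (∑-*ˡ xs k f)) (sym (*-distribˡ-+ k (f x) (∑ xs f)))

    ∑-++ : ∀ xs ys (f : A → ℕ) → ∑ (xs ++ ys) f ≡ ∑ xs f + ∑ ys f
    ∑-++ xs ys f = trans (cong sum (List.map-++ f xs ys)) (sum-++ (map f xs) (map f ys))

    length-filter≡∑𝟙 : ∀ {p} {P : Pred A p} (P? : Decidable P) xs → length (filter P? xs) ≡ ∑[ x ∈ xs ] 𝟙 (P? x)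
    length-filter≡∑𝟙 P? [] = refl
    length-filter≡∑𝟙 P? (x ∷ xs) with P? x
    ... | yes _ = cong suc (length-filter≡∑𝟙 P? xs)
    ... | no _ = length-filter≡∑𝟙 P? xs

    ∑-partition : ∀ {p} {P : Pred A p} (P? : Decidable P) xs (f : A → ℕ) →
                  ∑ xs f ≡ ∑ (filter P? xs) f + ∑ (filter (∁? P?) xs) f
    ∑-partition P? [] f = refl
    ∑-partition P? (x ∷ xs) f with P? x
    ... | yes _ = trans (cong (f x +_) (∑-partition P? xs f)) (sym (+-assoc (f x) _ _))
    ... | no _ = trans (cong (f x +_) (∑-partition P? xs f)) (x∙yz≈y∙xz (f x) (∑ (filter P? xs) f) (∑ (filter (∁? P?) xs) f))

    length-filter-∁ : ∀ {p} {P : Pred A p} (P? : Decidable P) xs →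
                      length (filter P? xs) + length (filter (∁? P?) xs) ≡ length xs
    length-filter-∁ P? xs = begin
      length (filter P? xs) + length (filter (∁? P?) xs)
        ≡⟨ cong₂ _+_ (length≡∑1 (filter P? xs)) (length≡∑1 (filter (∁? P?) xs)) ⟩
      ∑[ _ ∈ filter P? xs ] 1 + ∑[ _ ∈ filter (∁? P?) xs ] 1  ≡⟨ ∑-partition P? xs (λ _ → 1) ⟨
      ∑[ _ ∈ xs ] 1                                         ≡⟨ length≡∑1 xs ⟨
      length xs                                             ∎

    ∑-filter≤∑ : ∀ {p} {P : Pred A p} (P? : Decidable P) xs (f : A → ℕ) → ∑ (filter P? xs) f ≤ ∑ xs f
    ∑-filter≤∑ P? xs f = ≤-trans (m≤m+n _ _) (≤-reflexive (sym (∑-partition P? xs f)))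

    ∑-zero : ∀ xs {f : A → ℕ} → (∀ {x} → x ∈ xs → f x ≡ 0) → ∑ xs f ≡ 0
    ∑-zero xs f≡0 = trans (∑-cong xs f≡0) (trans (∑-const xs 0) (*-zeroʳ (length xs)))

    ∑𝟙≤1 : ∀ {p} {P : Pred A p} (P? : Decidable P) {xs} → Unique xs →
           (∀ {x y} → P x → P y → x ≡ y) → ∑[ x ∈ xs ] 𝟙 (P? x) ≤ 1
    ∑𝟙≤1 P? [] _ = z≤n
    ∑𝟙≤1 P? {x ∷ xs} (x∉xs ∷ unique) P-prop with P? x
    ... | no _ = ∑𝟙≤1 P? unique P-prop
    ... | yes Px = ≤-reflexive (cong suc (∑-zero xs (λ y∈xs → 𝟙-no (P? _) (All.lookup x∉xs y∈xs ∘ P-prop Px))))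

    ∑𝟙≤𝟙 : ∀ {p q} {P : Pred A p} {Q : Set q} (P? : Decidable P) (Q? : Dec Q) {xs} → Unique xs →
            (∀ {x y} → P x → P y → x ≡ y) → (∀ {x} → P x → Q) → ∑[ x ∈ xs ] 𝟙 (P? x) ≤ 𝟙 Q?
    ∑𝟙≤𝟙 P? (yes _) unique P-prop _ = ∑𝟙≤1 P? unique P-prop
    ∑𝟙≤𝟙 P? (no ¬Q) {xs} _ _ P⇒Q = ≤-reflexive (∑-zero xs (λ _ → 𝟙-no (P? _) (¬Q ∘ P⇒Q)))

    1≤∑𝟙 : ∀ {p} {P : Pred A p} (P? : Decidable P) {x xs} → x ∈ xs → P x → 1 ≤ ∑[ y ∈ xs ] 𝟙 (P? y)
    1≤∑𝟙 P? {xs = y ∷ xs} (here refl) Px = ≤-trans (≤-reflexive (sym (𝟙-yes (P? y) Px))) (m≤m+n _ _)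
    1≤∑𝟙 P? {xs = y ∷ xs} (there x∈xs) Px = ≤-trans (1≤∑𝟙 P? x∈xs Px) (m≤n+m _ _)

  ∑-map : ∀ {a b} {A : Set a} {B : Set b} (g : A → B) xs (f : B → ℕ) → ∑ (map g xs) f ≡ ∑[ x ∈ xs ] f (g x)
  ∑-map g xs f = cong sum (sym (List.map-∘ xs))

  module _ {a b} {A : Set a} {B : Set b} where

    ∑-cartesianProduct : ∀ xs ys (f : A × B → ℕ) →
      ∑ (cartesianProduct xs ys) f ≡ ∑[ x ∈ xs ] ∑[ y ∈ ys ] f (x , y)
    ∑-cartesianProduct [] ys f = refl
    ∑-cartesianProduct (x ∷ xs) ys f = trans (∑-++ (map (x ,_) ys) _ f)
      (cong₂ _+_ (∑-map (x ,_) ys f) (∑-cartesianProduct xs ys f))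

    ∑-comm : ∀ xs ys (f : A → B → ℕ) → ∑[ x ∈ xs ] ∑[ y ∈ ys ] f x y ≡ ∑[ y ∈ ys ] ∑[ x ∈ xs ] f x y
    ∑-comm [] ys f = sym (trans (∑-const ys 0) (*-zeroʳ (length ys)))
    ∑-comm (x ∷ xs) ys f = trans (cong (∑ ys (f x) +_) (∑-comm xs ys f)) (sym (∑-+ ys (f x) _))

    length-cartesianProduct : ∀ xs ys → length (cartesianProduct xs ys) ≡ length xs * length ys
    length-cartesianProduct xs ys = begin
      length (cartesianProduct xs ys)     ≡⟨ length≡∑1 (cartesianProduct xs ys) ⟩
      ∑[ _ ∈ cartesianProduct xs ys ] 1   ≡⟨ ∑-cartesianProduct xs ys (λ _ → 1) ⟩
      ∑[ _ ∈ xs ] ∑[ _ ∈ ys ] 1           ≡⟨ ∑-cong xs (λ _ → length≡∑1 ys) ⟨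
      ∑[ _ ∈ xs ] length ys               ≡⟨ ∑-const xs (length ys) ⟩
      length xs * length ys               ∎

  filter-some⁻ : ∀ {a p} {A : Set a} {P : Pred A p} (P? : Decidable P) xs → 0 < length (filter P? xs) → Any P xs
  filter-some⁻ P? (x ∷ xs) 0<|filter| with P? x
  ... | yes Px = here Px
  ... | no _ = there (filter-some⁻ P? xs 0<|filter|)

  distinct-pair : ∀ {a} {A : Set a} {xs : List A} → Unique xs → 2 ≤ length xs →
                  ∃[ x ] ∃[ y ] (x ∈ xs × y ∈ xs × x ≢ y)
  distinct-pair {xs = x ∷ y ∷ _} ((x≢y ∷ _) ∷ _) (s≤s (s≤s z≤n)) = x , y , here refl , there (here refl) , x≢y

  module _ {a} {A : Set a} (_≟_ : DecidableEquality A) where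
    open import Data.List.Membership.DecPropositional _≟_ using (_∈?_)

    ∑𝟙[x≟y]≡1 : ∀ {xs} → Unique xs → ∀ {y} → y ∈ xs → ∑[ x ∈ xs ] 𝟙 (x ≟ y) ≡ 1
    ∑𝟙[x≟y]≡1 uniq y∈xs =
      ≤-antisym (∑𝟙≤1 (_≟ _) uniq (λ x≡y z≡y → trans x≡y (sym z≡y))) (1≤∑𝟙 (_≟ _) y∈xs refl)

    ∑𝟙[x≟y]≡𝟙[x∈?ys] : ∀ {ys} → Unique ys → ∀ x → ∑[ y ∈ ys ] 𝟙 (x ≟ y) ≡ 𝟙 (x ∈? ys)
    ∑𝟙[x≟y]≡𝟙[x∈?ys] {ys} uniq x with x ∈? ys
    ... | yes x∈ys =
      ≤-antisym (∑𝟙≤1 (x ≟_) uniq (λ x≡y x≡z → trans (sym x≡y) x≡z)) (1≤∑𝟙 (x ≟_) x∈ys refl)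
    ... | no x∉ys = ∑-zero ys (λ y∈ys → 𝟙-no (x ≟ _) (λ { refl → x∉ys y∈ys }))

    length-filter-∈ : ∀ {xs ys} → Unique xs → Unique ys → (∀ {y} → y ∈ ys → y ∈ xs) →
                      length (filter (_∈? ys) xs) ≡ length ys
    length-filter-∈ {xs} {ys} uniq-xs uniq-ys ys⊆xs = begin
      length (filter (_∈? ys) xs)       ≡⟨ length-filter≡∑𝟙 (_∈? ys) xs ⟩
      ∑[ x ∈ xs ] 𝟙 (x ∈? ys)           ≡⟨ ∑-cong xs (λ {x} _ → ∑𝟙[x≟y]≡𝟙[x∈?ys] uniq-ys x) ⟨
      ∑[ x ∈ xs ] ∑[ y ∈ ys ] 𝟙 (x ≟ y) ≡⟨ ∑-comm xs ys (λ x y → 𝟙 (x ≟ y)) ⟩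
      ∑[ y ∈ ys ] ∑[ x ∈ xs ] 𝟙 (x ≟ y) ≡⟨ ∑-cong ys (λ y∈ys → ∑𝟙[x≟y]≡1 uniq-xs (ys⊆xs y∈ys)) ⟩
      ∑[ _ ∈ ys ] 1                     ≡⟨ length≡∑1 ys ⟨
      length ys                         ∎

    length-filter-≢ : ∀ {xs} → Unique xs → ∀ {y} → y ∈ xs → suc (length (filter (∁? (_≟ y)) xs)) ≡ length xs
    length-filter-≢ {xs} uniq {y} y∈xs =
      trans (cong (_+ length (filter (∁? (_≟ y)) xs)) (sym count-y)) (length-filter-∁ (_≟ y) xs)
      where
      count-y : length (filter (_≟ y) xs) ≡ 1
      count-y = trans (length-filter≡∑𝟙 (_≟ y) xs) (∑𝟙[x≟y]≡1 uniq y∈xs)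

open FiniteSums

module Collisions where
  open import Data.Nat using (_+_; _*_; _≤_; z≤n)
  open import Data.Nat.Properties using (+-mono-≤; *-monoʳ-≤; module ≤-Reasoning)

  module _ {a b} {A : Set a} {B : Set b} (_≟_ : DecidableEquality B) (h : A → B) where

    collisions : List A → ℕ
    collisions xs = ∑[ x ∈ xs ] ∑[ y ∈ xs ] 𝟙 (h x ≟ h y)

    length²≤length*collisions : ∀ ys xs → All (λ x → h x ∈ ys) xs →
                                length xs * length xs ≤ length ys * collisions xs
    length²≤length*collisions [] [] [] = z≤n
    length²≤length*collisions (y ∷ ys) xs hxs∈y∷ys = begin
      length xs * length xs                  ≡⟨ cong (λ n → n * n) length-xs ⟩
      (length xs₁ + length xs₂) * (length xs₁ + length xs₂)
        ≤⟨ [a+b]²≤[1+M][a²+c] (length xs₁) (length xs₂) (length ys) (collisions xs₂) induction ⟩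
      suc (length ys) * (length xs₁ * length xs₁ + collisions xs₂)
        ≤⟨ *-monoʳ-≤ (suc (length ys)) (+-mono-≤ block₁ block₂) ⟩
      suc (length ys) * (∑ xs₁ rowCount + ∑ xs₂ rowCount)
        ≡⟨ cong (suc (length ys) *_) (∑-partition (λ x → h x ≟ y) xs rowCount) ⟨
      suc (length ys) * collisions xs        ∎
      where
      open ≤-Reasoning
      hits? = λ x → h x ≟ y
      xs₁ = filter hits? xs
      xs₂ = filter (∁? hits?) xs
      rowCount : A → ℕ
      rowCount x = ∑[ z ∈ xs ] 𝟙 (h x ≟ h z)
      length-xs : length xs ≡ length xs₁ + length xs₂
      length-xs = sym (length-filter-∁ hits? xs)
      xs₂⊆ys : All (λ x → h x ∈ ys) xs₂
      xs₂⊆ys = All.tabulate λ x∈xs₂ → let (x∈xs , hx≢y) = ∈-filter⁻ (∁? hits?) {xs = xs} x∈xs₂ in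
        drop-head (All.lookup hxs∈y∷ys x∈xs) hx≢y
        where
        drop-head : ∀ {z} → z ∈ y ∷ ys → z ≢ y → z ∈ ys
        drop-head (here z≡y) z≢y = contradiction z≡y z≢y
        drop-head (there z∈ys) _ = z∈ys
      induction : length xs₂ * length xs₂ ≤ length ys * collisions xs₂
      induction = length²≤length*collisions ys xs₂ xs₂⊆ys
      block₁ : length xs₁ * length xs₁ ≤ ∑ xs₁ rowCount
      block₁ = begin
        length xs₁ * length xs₁  ≡⟨ ∑-const xs₁ (length xs₁) ⟨
        ∑[ _ ∈ xs₁ ] length xs₁  ≤⟨ ∑-mono xs₁ row₁ ⟩
        ∑ xs₁ rowCount           ∎
        where
        row₁ : ∀ {x} → x ∈ xs₁ → length xs₁ ≤ rowCount x
        row₁ {x} x∈xs₁ = begin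
          length xs₁                        ≡⟨ length≡∑1 xs₁ ⟩
          ∑[ _ ∈ xs₁ ] 1                    ≡⟨ ∑-cong xs₁ (λ z∈xs₁ → 𝟙-yes (h x ≟ h _) (hx≡hz z∈xs₁)) ⟨
          ∑[ z ∈ xs₁ ] 𝟙 (h x ≟ h z)        ≤⟨ ∑-filter≤∑ hits? xs (λ z → 𝟙 (h x ≟ h z)) ⟩
          rowCount x                        ∎
          where
          hx≡y : ∀ {z} → z ∈ xs₁ → h z ≡ y
          hx≡y z∈xs₁ = proj₂ (∈-filter⁻ hits? {xs = xs} z∈xs₁)
          hx≡hz : ∀ {z} → z ∈ xs₁ → h x ≡ h z
          hx≡hz z∈xs₁ = trans (hx≡y x∈xs₁) (sym (hx≡y z∈xs₁))
      block₂ : collisions xs₂ ≤ ∑ xs₂ rowCount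
      block₂ = ∑-mono xs₂ (λ {x} _ → ∑-filter≤∑ (∁? hits?) xs (λ z → 𝟙 (h x ≟ h z)))

open Collisions

module FreeActions where
  open import Data.Nat using (_+_; _<_; z≤n; s≤s; >-nonZero⁻¹)
  open import Data.Nat.Properties using (<-trans; n<1+n; m<n+m; suc-pred; +-comm)
  open import Data.Nat.GeneralisedArithmetic using (iterate)
  open import Data.Nat.Induction using (<-wellFounded)
  open import Data.Nat.Divisibility using (_∣0; ∣-refl; ∣m∣n⇒∣m+n)
  open import Induction.WellFounded using (Acc; acc)
  open ≡-Reasoning

  module _ {a} {A : Set a} (σ : A → A) where

    iterate-+ : ∀ x m n → iterate σ x (m + n) ≡ iterate σ (iterate σ x m) n
    iterate-+ x zero n = refl
    iterate-+ x (suc m) n = iterate-+ (σ x) m n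

    ∈-iterate⁺ : ∀ x {j n} → j < n → iterate σ x j ∈ List.iterate σ x n
    ∈-iterate⁺ x {zero} {suc n} _ = here refl
    ∈-iterate⁺ x {suc j} {suc n} (s≤s j<n) = there (∈-iterate⁺ (σ x) j<n)

    ∈-iterate⁻ : ∀ x n {y} → y ∈ List.iterate σ x n → ∃[ j ] (j < n × y ≡ iterate σ x j)
    ∈-iterate⁻ x (suc n) (here y≡x) = 0 , s≤s z≤n , y≡x
    ∈-iterate⁻ x (suc n) (there y∈) with j , j<n , y≡ ← ∈-iterate⁻ (σ x) n y∈ = suc j , s≤s j<n , y≡

  module _ {a} {A : Set a} (_≟_ : DecidableEquality A) (σ : A → A) (k : ℕ) .{{_ : NonZero k}}
           (σ^k≗id : ∀ x → iterate σ x k ≡ x) where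
    open import Data.List.Membership.DecPropositional _≟_ using (_∈?_)

    orbit : A → List A
    orbit x = List.iterate σ x k

    σ-Closed : List A → Set a
    σ-Closed xs = ∀ {x} → x ∈ xs → σ x ∈ xs

    σ^[k-1]∘σ≗id : ∀ y → iterate σ (σ y) (pred k) ≡ y
    σ^[k-1]∘σ≗id y = subst (λ m → iterate σ y m ≡ y) (sym (suc-pred k)) (σ^k≗id y)

    ∈-orbit-σ⁻ : ∀ {x y} → σ y ∈ orbit x → y ∈ orbit x
    ∈-orbit-σ⁻ {x} {y} σy∈orbit with ∈-iterate⁻ σ x k σy∈orbit
    ... | zero , _ , σy≡x =
      subst (_∈ orbit x) (trans (cong (λ z → iterate σ z (pred k)) (sym σy≡x)) (σ^[k-1]∘σ≗id y))
            (∈-iterate⁺ σ x (subst (pred k <_) (suc-pred k) (n<1+n (pred k))))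
    ... | suc j , j+1<k , σy≡ = subst (_∈ orbit x) y≡σ^jx (∈-iterate⁺ σ x (<-trans (n<1+n j) j+1<k))
      where
      k+j≡1+j+[k-1] : k + j ≡ suc j + pred k
      k+j≡1+j+[k-1] = trans (cong (_+ j) (sym (suc-pred k))) (cong suc (+-comm (pred k) j))
      y≡σ^jx : iterate σ x j ≡ y
      y≡σ^jx = begin
        iterate σ x j                           ≡⟨ cong (λ z → iterate σ z j) (σ^k≗id x) ⟨
        iterate σ (iterate σ x k) j             ≡⟨ iterate-+ σ x k j ⟨
        iterate σ x (k + j)                     ≡⟨ cong (iterate σ x) k+j≡1+j+[k-1] ⟩
        iterate σ x (suc j + pred k)            ≡⟨ iterate-+ σ x (suc j) (pred k) ⟩
        iterate σ (iterate σ x (suc j)) (pred k) ≡⟨ cong (λ z → iterate σ z (pred k)) σy≡ ⟨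
        iterate σ (σ y) (pred k)                ≡⟨ σ^[k-1]∘σ≗id y ⟩
        y                                       ∎

    orbit⊆ : ∀ {xs x} → σ-Closed xs → x ∈ xs → ∀ {y} → y ∈ orbit x → y ∈ xs
    orbit⊆ {xs} closed x∈xs y∈orbit with j , _ , refl ← ∈-iterate⁻ σ _ k y∈orbit = iterate∈ j x∈xs
      where
      iterate∈ : ∀ j {x} → x ∈ xs → iterate σ x j ∈ xs
      iterate∈ zero x∈xs = x∈xs
      iterate∈ (suc j) x∈xs = iterate∈ j (closed x∈xs)

    k∣length : ∀ {xs} → Unique xs → σ-Closed xs → (∀ {x} → x ∈ xs → Unique (orbit x)) → k ∣ length xs
    k∣length {xs} = go xs (<-wellFounded (length xs))
      where
      go : ∀ xs → Acc _<_ (length xs) → Unique xs → σ-Closed xs → (∀ {x} → x ∈ xs → Unique (orbit x)) →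
           k ∣ length xs
      go [] _ _ _ _ = k ∣0
      go xs@(x ∷ _) (acc rec) uniq closed orbits-unique =
        subst (k ∣_) length-xs (∣m∣n⇒∣m+n ∣-refl (go ys (rec |ys|<|xs|) uniq-ys closed-ys (orbits-unique ∘ ys⊆xs)))
        where
        O = orbit x
        outside? = ∁? (_∈? O)
        ys = filter outside? xs
        ys⊆xs : ∀ {y} → y ∈ ys → y ∈ xs
        ys⊆xs y∈ys = proj₁ (∈-filter⁻ outside? {xs = xs} y∈ys)
        length-xs : k + length ys ≡ length xs
        length-xs = begin
          k + length ys                             ≡⟨ cong (_+ length ys) (List.length-iterate σ x k) ⟨
          length O + length ys                      ≡⟨ cong (_+ length ys) length-O ⟨
          length (filter (_∈? O) xs) + length ys    ≡⟨ length-filter-∁ (_∈? O) xs ⟩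
          length xs                                 ∎
          where
          length-O : length (filter (_∈? O) xs) ≡ length O
          length-O = length-filter-∈ _≟_ uniq (orbits-unique (here refl)) (orbit⊆ closed (here refl))
        |ys|<|xs| : length ys < length xs
        |ys|<|xs| = subst (length ys <_) length-xs (m<n+m (length ys) (>-nonZero⁻¹ k))
        uniq-ys : Unique ys
        uniq-ys = Unique.filter⁺ outside? uniq
        closed-ys : σ-Closed ys
        closed-ys y∈ys = let (y∈xs , y∉O) = ∈-filter⁻ outside? {xs = xs} y∈ys in
          ∈-filter⁺ outside? (closed y∈xs) (y∉O ∘ ∈-orbit-σ⁻)

open FreeActions

module IntegerRingSolver {c ℓ} (R : CommutativeRing c ℓ) where

  open CommutativeRing R hiding (refl; sym; trans; reflexive)
  private module R = CommutativeRing R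
  open import Algebra.Properties.Ring ring using (-‿involutive; -0#≈0#; -‿distribˡ-*; -‿distribʳ-*; -‿anti-homo-+)
  open import Algebra.Properties.Semiring.Mult.TCOptimised semiring using (1+×; ×-homo-+; ×1-homo-*)
    renaming (_×_ to _×′_)
  open import Relation.Binary.Reasoning.Setoid R.setoid

  -- Uses the optimised multiple _×′_, for which 1 ×′ 1# reduces to 1#: the solver constant con (pos 1)
  -- then evaluates to 1# itself, so goals mentioning 1# are solved by refl.
  fromℤ : ℤ → Carrier
  fromℤ (pos n) = n ×′ 1#
  fromℤ (negsuc n) = - (suc n ×′ 1#)

  fromℤ-homo-⊖ : ∀ m n → fromℤ (m ⊖ n) ≈ m ×′ 1# + - (n ×′ 1#)
  fromℤ-homo-⊖ m zero = R.sym (R.trans (+-congˡ -0#≈0#) (+-identityʳ _))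
  fromℤ-homo-⊖ zero (suc n) = R.sym (+-identityˡ _)
  fromℤ-homo-⊖ (suc m) (suc n) = begin
    fromℤ (suc m ⊖ suc n)        ≡⟨ cong fromℤ (ℤ.[1+m]⊖[1+n]≡m⊖n m n) ⟩
    fromℤ (m ⊖ n)                ≈⟨ fromℤ-homo-⊖ m n ⟩
    a + - b                      ≈⟨ +-congʳ (+-identityˡ a) ⟨
    (0# + a) + - b               ≈⟨ +-congʳ (+-congʳ (-‿inverseʳ 1#)) ⟨
    ((1# + - 1#) + a) + - b      ≈⟨ +-congʳ (R.trans (+-assoc 1# (- 1#) a) (+-congˡ (+-comm (- 1#) a))) ⟩
    (1# + (a + - 1#)) + - b      ≈⟨ +-congʳ (+-assoc 1# a (- 1#)) ⟨
    ((1# + a) + - 1#) + - b      ≈⟨ +-assoc (1# + a) (- 1#) (- b) ⟩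
    (1# + a) + (- 1# + - b)      ≈⟨ +-congˡ (R.trans (+-comm (- 1#) (- b)) (R.sym (-‿anti-homo-+ 1# b))) ⟩
    (1# + a) + - (1# + b)        ≈⟨ +-cong (1+× m 1#) (-‿cong (1+× n 1#)) ⟨
    suc m ×′ 1# + - (suc n ×′ 1#)  ∎
    where
    a = m ×′ 1#
    b = n ×′ 1#

  fromℤ-homo-neg : ∀ i → fromℤ (ℤ.- i) ≈ - fromℤ i
  fromℤ-homo-neg (pos zero) = R.sym -0#≈0#
  fromℤ-homo-neg (pos (suc n)) = R.refl
  fromℤ-homo-neg (negsuc n) = R.sym (-‿involutive _)

  fromℤ-homo-+ : ∀ i j → fromℤ (i ℤ.+ j) ≈ fromℤ i + fromℤ j
  fromℤ-homo-+ (pos m) (pos n) = ×-homo-+ 1# m n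
  fromℤ-homo-+ (pos m) (negsuc n) = fromℤ-homo-⊖ m (suc n)
  fromℤ-homo-+ (negsuc m) (pos n) = R.trans (fromℤ-homo-⊖ n (suc m)) (+-comm _ _)
  fromℤ-homo-+ (negsuc m) (negsuc n) = begin
    - (suc (suc (m ℕ.+ n)) ×′ 1#)     ≡⟨ cong (λ k → - (suc k ×′ 1#)) (ℕ.+-suc m n) ⟨
    - ((suc m ℕ.+ suc n) ×′ 1#)       ≈⟨ -‿cong (×-homo-+ 1# (suc m) (suc n)) ⟩
    - (suc m ×′ 1# + suc n ×′ 1#)      ≈⟨ -‿anti-homo-+ _ _ ⟩
    - (suc n ×′ 1#) + - (suc m ×′ 1#)  ≈⟨ +-comm _ _ ⟩
    - (suc m ×′ 1#) + - (suc n ×′ 1#)  ∎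

  fromℤ-homo-*-pos : ∀ m j → fromℤ (pos m ℤ.* j) ≈ m ×′ 1# * fromℤ j
  fromℤ-homo-*-pos m (pos n) = R.trans (R.reflexive (cong fromℤ (sym (ℤ.pos-* m n)))) (×1-homo-* m n)
  fromℤ-homo-*-pos m (negsuc n) = begin
    fromℤ (pos m ℤ.* negsuc n)             ≡⟨ cong fromℤ (ℤ.neg-distribʳ-* (pos m) (pos (suc n))) ⟨
    fromℤ (ℤ.- (pos m ℤ.* pos (suc n)))    ≈⟨ fromℤ-homo-neg (pos m ℤ.* pos (suc n)) ⟩
    - fromℤ (pos m ℤ.* pos (suc n))        ≈⟨ -‿cong (fromℤ-homo-*-pos m (pos (suc n))) ⟩
    - (m ×′ 1# * fromℤ (pos (suc n)))       ≈⟨ -‿distribʳ-* _ _ ⟩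
    m ×′ 1# * fromℤ (negsuc n)              ∎

  fromℤ-homo-* : ∀ i j → fromℤ (i ℤ.* j) ≈ fromℤ i * fromℤ j
  fromℤ-homo-* (pos m) j = fromℤ-homo-*-pos m j
  fromℤ-homo-* (negsuc m) j = begin
    fromℤ (negsuc m ℤ.* j)                 ≡⟨ cong fromℤ (ℤ.neg-distribˡ-* (pos (suc m)) j) ⟨
    fromℤ (ℤ.- (pos (suc m) ℤ.* j))        ≈⟨ fromℤ-homo-neg (pos (suc m) ℤ.* j) ⟩
    - fromℤ (pos (suc m) ℤ.* j)            ≈⟨ -‿cong (fromℤ-homo-*-pos (suc m) j) ⟩
    - (fromℤ (pos (suc m)) * fromℤ j)      ≈⟨ -‿distribˡ-* _ _ ⟩
    fromℤ (negsuc m) * fromℤ j             ∎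

  fromℤ-morphism : ℤ.+-*-rawRing -Raw-AlmostCommutative⟶ fromCommutativeRing R
  fromℤ-morphism = record
    { ⟦_⟧ = fromℤ ; +-homo = fromℤ-homo-+ ; *-homo = fromℤ-homo-* ; -‿homo = fromℤ-homo-neg
    ; 0-homo = R.refl ; 1-homo = R.refl }

  fromℤ-equal? : ∀ i j → Maybe (fromℤ i ≈ fromℤ j)
  fromℤ-equal? i j with i ℤ.≟ j
  ... | yes i≡j = just (R.reflexive (cong fromℤ i≡j))
  ... | no _ = nothing

  open import Algebra.Solver.Ring ℤ.+-*-rawRing (fromCommutativeRing R) fromℤ-morphism fromℤ-equal? public
    using (solve; _:=_; con; _:+_; _:*_; :-_; _:-_)

module _ (F : FiniteField) where
  open FiniteField F

  commutativeRing : CommutativeRing 0ℓ 0ℓ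
  commutativeRing = record { isCommutativeRing = isCommutativeRing }

  open CommutativeRing commutativeRing using (+-comm; *-comm; -‿inverseʳ; zeroʳ; *-identityʳ; ring)
  open import Algebra.Properties.Ring ring using (+-cancelˡ; +-inverseˡ-unique; -‿involutive; x∙y⁻¹≈ε⇒x≈y)
  open IntegerRingSolver commutativeRing using (solve; _:=_; con; _:+_; _:*_; :-_; _:-_)

  0<size : 0 ℕ.< size
  0<size with elements | elements-complete 0#
  ... | _ ∷ _ | _ = ℕ.s≤s ℕ.z≤n

  1≢0 : 1# ≢ 0#
  1≢0 = 0≢1 ∘ sym

  ⁻¹-cancelˡ : ∀ {x} → x ≢ 0# → ∀ y → x ⁻¹ * (x * y) ≡ y
  ⁻¹-cancelˡ {x} x≢0 y = begin
    x ⁻¹ * (x * y)   ≡⟨ solve 3 (λ x x⁻¹ y → x⁻¹ :* (x :* y) := (x :* x⁻¹) :* y) refl x (x ⁻¹) y ⟩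
    (x * x ⁻¹) * y   ≡⟨ cong (_* y) (⁻¹-inverse x x≢0) ⟩
    1# * y           ≡⟨ solve 1 (λ y → con (pos 1) :* y := y) refl y ⟩
    y                ∎
    where open ≡-Reasoning

  *-cancelˡ-nonZero : ∀ {x} → x ≢ 0# → ∀ {y z} → x * y ≡ x * z → y ≡ z
  *-cancelˡ-nonZero x≢0 {y} {z} xy≡xz =
    trans (sym (⁻¹-cancelˡ x≢0 y)) (trans (cong (_ ⁻¹ *_) xy≡xz) (⁻¹-cancelˡ x≢0 z))

  *-nonZero : ∀ {x y} → x ≢ 0# → y ≢ 0# → x * y ≢ 0#
  *-nonZero {x} {y} x≢0 y≢0 xy≡0 = y≢0 (*-cancelˡ-nonZero x≢0 (trans xy≡0 (sym (zeroʳ x))))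

  1+1≡0⇒2∣q : 1# + 1# ≡ 0# → 2 ∣ size
  1+1≡0⇒2∣q 1+1≡0 = k∣length _≟_ (_+ 1#) 2 period elements-unique (λ _ → elements-complete _) orbit-unique
    where
    open ≡-Reasoning
    period : ∀ x → (x + 1#) + 1# ≡ x
    period x = begin
      (x + 1#) + 1#   ≡⟨ solve 2 (λ x o → (x :+ o) :+ o := x :+ (o :+ o)) refl x 1# ⟩
      x + (1# + 1#)   ≡⟨ cong (x +_) 1+1≡0 ⟩
      x + 0#          ≡⟨ solve 1 (λ x → x :+ con (pos 0) := x) refl x ⟩
      x               ∎
    x≢x+1 : ∀ x → x ≢ x + 1#
    x≢x+1 x x≡x+1 = 0≢1 (+-cancelˡ x 0# 1# (trans (solve 1 (λ x → x :+ con (pos 0) := x) refl x) x≡x+1))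
    orbit-unique : ∀ {x} → x ∈ elements → Unique (x ∷ x + 1# ∷ [])
    orbit-unique {x} _ = (x≢x+1 x ∷ []) ∷ [] ∷ []

  -x≢x : 1# + 1# ≢ 0# → ∀ {x} → x ≢ 0# → - x ≢ x
  -x≢x 2≢0 {x} x≢0 -x≡x = *-nonZero 2≢0 x≢0 (begin
    (1# + 1#) * x  ≡⟨ solve 1 (λ x → (con (pos 1) :+ con (pos 1)) :* x := x :+ x) refl x ⟩
    x + x          ≡⟨ cong (x +_) -x≡x ⟨
    x + - x        ≡⟨ -‿inverseʳ x ⟩
    0#             ∎)
    where open ≡-Reasoning

  module _ (2≢0 : 1# + 1# ≢ 0#) {i} (i²≡-1 : i * i ≡ - 1#) where
    open ≡-Reasoning

    i≢0 : i ≢ 0#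
    i≢0 i≡0 = 1≢0 (begin
      1#            ≡⟨ -‿involutive 1# ⟨
      - - 1#        ≡⟨ cong -_ i²≡-1 ⟨
      - (i * i)     ≡⟨ cong (λ z → - (z * z)) i≡0 ⟩
      - (0# * 0#)   ≡⟨ solve 0 (:- (con (pos 0) :* con (pos 0)) := con (pos 0)) refl ⟩
      0#            ∎)

    i⁴x≡x : ∀ x → i * (i * (i * (i * x))) ≡ x
    i⁴x≡x x = begin
      i * (i * (i * (i * x)))      ≡⟨ solve 2 (λ i x → i :* (i :* (i :* (i :* x))) := (i :* i) :* ((i :* i) :* x)) refl i x ⟩
      (i * i) * ((i * i) * x)      ≡⟨ cong₂ (λ u v → u * (v * x)) i²≡-1 i²≡-1 ⟩
      - 1# * (- 1# * x)            ≡⟨ solve 1 (λ x → (:- con (pos 1)) :* ((:- con (pos 1)) :* x) := x) refl x ⟩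
      x                            ∎

    ix≢x : ∀ {x} → x ≢ 0# → i * x ≢ x
    ix≢x {x} x≢0 ix≡x = -x≢x 2≢0 1≢0 (begin
      - 1#     ≡⟨ i²≡-1 ⟨
      i * i    ≡⟨ cong₂ _*_ i≡1 i≡1 ⟩
      1# * 1#  ≡⟨ *-identityʳ 1# ⟩
      1#       ∎)
      where
      i≡1 : i ≡ 1#
      i≡1 = *-cancelˡ-nonZero x≢0 (trans (*-comm x i) (trans ix≡x (sym (*-identityʳ x))))

    i²x≢x : ∀ {x} → x ≢ 0# → i * (i * x) ≢ x
    i²x≢x {x} x≢0 i²x≡x = -x≢x 2≢0 x≢0 (begin
      - x              ≡⟨ solve 1 (λ x → :- x := (:- con (pos 1)) :* x) refl x ⟩
      - 1# * x         ≡⟨ cong (_* x) i²≡-1 ⟨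
      (i * i) * x      ≡⟨ solve 2 (λ i x → (i :* i) :* x := i :* (i :* x)) refl i x ⟩
      i * (i * x)      ≡⟨ i²x≡x ⟩
      x                ∎)

    orbit-unique : ∀ {x} → x ≢ 0# → Unique (x ∷ i * x ∷ i * (i * x) ∷ i * (i * (i * x)) ∷ [])
    orbit-unique {x} x≢0 =
      (ix≢x x≢0 ∘ sym ∷ i²x≢x x≢0 ∘ sym ∷ x≢i³x ∷ []) ∷
      (ix≢x ix≢0 ∘ sym ∷ i²x≢x ix≢0 ∘ sym ∷ []) ∷
      (ix≢x (*-nonZero i≢0 ix≢0) ∘ sym ∷ []) ∷ [] ∷ []
      where
      ix≢0 = *-nonZero i≢0 x≢0
      x≢i³x : x ≢ i * (i * (i * x))
      x≢i³x x≡i³x = ix≢x x≢0 (trans (cong (i *_) x≡i³x) (i⁴x≡x x))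

    4∣q-1 : 4 ∣ pred size
    4∣q-1 = subst (4 ∣_) |F*|≡q-1
      (k∣length _≟_ (i *_) 4 i⁴x≡x (Unique.filter⁺ nonZero? elements-unique) closed (orbit-unique ∘ nonZero))
      where
      nonZero? = ∁? (_≟ 0#)
      F* = filter nonZero? elements
      nonZero : ∀ {x} → x ∈ F* → x ≢ 0#
      nonZero x∈F* = proj₂ (∈-filter⁻ nonZero? {xs = elements} x∈F*)
      |F*|≡q-1 : length F* ≡ pred size
      |F*|≡q-1 = cong pred (length-filter-≢ _≟_ elements-unique (elements-complete 0#))
      closed : ∀ {x} → x ∈ F* → i * x ∈ F*
      closed x∈F* = ∈-filter⁺ nonZero? (elements-complete _) (*-nonZero i≢0 (nonZero x∈F*))

  x²+y²≡0⇒y≡0 : (∀ i → i * i ≢ - 1#) → ∀ x y → x * x + y * y ≡ 0# → y ≡ 0#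
  x²+y²≡0⇒y≡0 i²≢-1 x y x²+y²≡0 with y ≟ 0#
  ... | yes y≡0 = y≡0
  ... | no y≢0 = contradiction [x/y]²≡-1 (i²≢-1 (x * y ⁻¹))
    where
    open ≡-Reasoning
    [x/y]²≡-1 : (x * y ⁻¹) * (x * y ⁻¹) ≡ - 1#
    [x/y]²≡-1 = begin
      (x * y ⁻¹) * (x * y ⁻¹)          ≡⟨ solve 2 (λ x z → (x :* z) :* (x :* z) := (x :* x) :* (z :* z)) refl x (y ⁻¹) ⟩
      (x * x) * (y ⁻¹ * y ⁻¹)          ≡⟨ cong (_* (y ⁻¹ * y ⁻¹)) (+-inverseˡ-unique (x * x) (y * y) x²+y²≡0) ⟩
      - (y * y) * (y ⁻¹ * y ⁻¹)        ≡⟨ solve 2 (λ y z → (:- (y :* y)) :* (z :* z) := :- ((y :* z) :* (y :* z)))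
                                              refl y (y ⁻¹) ⟩
      - ((y * y ⁻¹) * (y * y ⁻¹))      ≡⟨ cong (λ u → - (u * u)) (⁻¹-inverse y y≢0) ⟩
      - (1# * 1#)                      ≡⟨ cong -_ (*-identityʳ 1#) ⟩
      - 1#                             ∎

  ‖_‖ : Point F → Carrier
  ‖_‖ = norm F

  infixl 6 _-ᵖ_
  _-ᵖ_ : Point F → Point F → Point F
  _-ᵖ_ = diffᵖ F

  infixl 7 _·_
  _·_ : Point F → Point F → Point F
  (a , b) · (c , d) = (a * c + - (b * d) , a * d + b * c)

  ‖·‖ : ∀ u v → ‖ u · v ‖ ≡ ‖ u ‖ * ‖ v ‖
  ‖·‖ (a , b) (c , d) = solve 4 (λ a b c d →
    (a :* c :- b :* d) :* (a :* c :- b :* d) :+ (a :* d :+ b :* c) :* (a :* d :+ b :* c)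
      := (a :* a :+ b :* b) :* (c :* c :+ d :* d)) refl a b c d

  ·-distribˡ-ᵖ : ∀ u v w → u · (v -ᵖ w) ≡ u · v -ᵖ u · w
  ·-distribˡ-ᵖ (a , b) (c , d) (e , f) = cong₂ _,_
    (solve 6 (λ a b c d e f → a :* (c :- e) :- b :* (d :- f) := (a :* c :- b :* d) :- (a :* e :- b :* f)) refl a b c d e f)
    (solve 6 (λ a b c d e f → a :* (d :- f) :+ b :* (c :- e) := (a :* d :+ b :* c) :- (a :* f :+ b :* e)) refl a b c d e f)

  infixr 7 _∙_
  _∙_ : Carrier → Point F → Point F
  s ∙ (a , b) = (s * a , s * b)

  ∙-cancelˡ : ∀ {s} → s ≢ 0# → ∀ {u v} → s ∙ u ≡ s ∙ v → u ≡ v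
  ∙-cancelˡ s≢0 su≡sv =
    cong₂ _,_ (*-cancelˡ-nonZero s≢0 (cong proj₁ su≡sv)) (*-cancelˡ-nonZero s≢0 (cong proj₂ su≡sv))

  conj : Point F → Point F
  conj (c , d) = (c , - d)

  ·-conj : ∀ u v → (u · v) · conj v ≡ ‖ v ‖ ∙ u
  ·-conj (a , b) (c , d) = cong₂ _,_
    (solve 4 (λ a b c d → (a :* c :- b :* d) :* c :- (a :* d :+ b :* c) :* (:- d) := (c :* c :+ d :* d) :* a) refl a b c d)
    (solve 4 (λ a b c d → (a :* c :- b :* d) :* (:- d) :+ (a :* d :+ b :* c) :* c := (c :* c :+ d :* d) :* b) refl a b c d)

  ·-cancelʳ : ∀ {v} → ‖ v ‖ ≢ 0# → ∀ {u w} → u · v ≡ w · v → u ≡ w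
  ·-cancelʳ {v} ‖v‖≢0 {u} {w} uv≡wv =
    ∙-cancelˡ ‖v‖≢0 (trans (sym (·-conj u v)) (trans (cong (_· conj v) uv≡wv) (·-conj w v)))

  ‖∙‖ : ∀ s u → ‖ s ∙ u ‖ ≡ (s * s) * ‖ u ‖
  ‖∙‖ s (a , b) = solve 3 (λ s a b → (s :* a) :* (s :* a) :+ (s :* b) :* (s :* b) := (s :* s) :* (a :* a :+ b :* b)) refl s a b

  0ᵖ : Point F
  0ᵖ = (0# , 0#)

  -ᵖ≡0ᵖ⇒≡ : ∀ {u v} → u -ᵖ v ≡ 0ᵖ → u ≡ v
  -ᵖ≡0ᵖ⇒≡ {a , b} {c , d} u-v≡0 =
    cong₂ _,_ (x∙y⁻¹≈ε⇒x≈y a c (cong proj₁ u-v≡0)) (x∙y⁻¹≈ε⇒x≈y b d (cong proj₂ u-v≡0))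

  _≟ᵖ_ : DecidableEquality (Point F)
  _≟ᵖ_ = ≡-dec _≟_ _≟_

  _≟²_ : DecidableEquality (Point F × Point F)
  _≟²_ = ≡-dec _≟ᵖ_ _≟ᵖ_

  -ᵖ-swap : ∀ {a b u v} → a -ᵖ u ≡ b -ᵖ v → a -ᵖ b ≡ u -ᵖ v
  -ᵖ-swap {a₁ , a₂} {b₁ , b₂} {u₁ , u₂} {v₁ , v₂} eq = cong₂ _,_ (swap (cong proj₁ eq)) (swap (cong proj₂ eq))
    where
    open ≡-Reasoning
    swap : ∀ {a b u v} → a + - u ≡ b + - v → a + - b ≡ u + - v
    swap {a} {b} {u} {v} a-u≡b-v = begin
      a + - b              ≡⟨ solve 3 (λ a b u → a :- b := (a :- u) :+ (u :- b)) refl a b u ⟩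
      (a + - u) + (u + - b)  ≡⟨ cong (_+ (u + - b)) a-u≡b-v ⟩
      (b + - v) + (u + - b)  ≡⟨ solve 3 (λ b u v → (b :- v) :+ (u :- b) := u :- v) refl b u v ⟩
      u + - v              ∎

  u-ᵖu≡0ᵖ : ∀ u → u -ᵖ u ≡ 0ᵖ
  u-ᵖu≡0ᵖ (a , b) = cong₂ _,_ (-‿inverseʳ a) (-‿inverseʳ b)

  collision-diagonal : ∀ {l a b c} → a -ᵖ l · c ≡ b -ᵖ l · c → a ≡ b
  collision-diagonal {l} {c = c} eq = -ᵖ≡0ᵖ⇒≡ (trans (-ᵖ-swap eq) (u-ᵖu≡0ᵖ (l · c)))

  collision-difference : ∀ {l a b c d} → a -ᵖ l · c ≡ b -ᵖ l · d → a -ᵖ b ≡ l · (c -ᵖ d)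
  collision-difference {l} {c = c} {d} eq = trans (-ᵖ-swap eq) (sym (·-distribˡ-ᵖ l c d))

  module _ (i²≢-1 : ∀ i → i * i ≢ - 1#) where

    ‖u‖≡0⇒u≡0ᵖ : ∀ {u} → ‖ u ‖ ≡ 0# → u ≡ 0ᵖ
    ‖u‖≡0⇒u≡0ᵖ {a , b} a²+b²≡0 = cong₂ _,_
      (x²+y²≡0⇒y≡0 i²≢-1 b a (trans (+-comm (b * b) (a * a)) a²+b²≡0))
      (x²+y²≡0⇒y≡0 i²≢-1 a b a²+b²≡0)

    ‖u-v‖≢0 : ∀ {u v} → u ≢ v → ‖ u -ᵖ v ‖ ≢ 0#
    ‖u-v‖≢0 u≢v = u≢v ∘ -ᵖ≡0ᵖ⇒≡ ∘ ‖u‖≡0⇒u≡0ᵖ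

    collision⇒GoodQuad : ∀ {r l a b c d} → ‖ l ‖ ≡ r → c ≢ d → a -ᵖ l · c ≡ b -ᵖ l · d →
                         GoodQuad F r (a , b , c , d)
    collision⇒GoodQuad {r} {l} {a} {b} {c} {d} ‖l‖≡r c≢d eq = ‖u-v‖≢0 c≢d , (begin
      ‖ a -ᵖ b ‖ * N ⁻¹        ≡⟨ cong (λ u → ‖ u ‖ * N ⁻¹) (collision-difference eq) ⟩
      ‖ l · (c -ᵖ d) ‖ * N ⁻¹  ≡⟨ cong (_* N ⁻¹) (‖·‖ l (c -ᵖ d)) ⟩
      (‖ l ‖ * N) * N ⁻¹       ≡⟨ solve 3 (λ x n n⁻¹ → x :* n :* n⁻¹ := x :* (n :* n⁻¹)) refl ‖ l ‖ N (N ⁻¹) ⟩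
      ‖ l ‖ * (N * N ⁻¹)       ≡⟨ cong₂ _*_ ‖l‖≡r (⁻¹-inverse N (‖u-v‖≢0 c≢d)) ⟩
      r * 1#                   ≡⟨ *-identityʳ r ⟩
      r                        ∎)
      where
      open ≡-Reasoning
      N = ‖ c -ᵖ d ‖

    collision-unique : ∀ {l m a b c d} → c ≢ d → a -ᵖ l · c ≡ b -ᵖ l · d → a -ᵖ m · c ≡ b -ᵖ m · d → l ≡ m
    collision-unique c≢d eqₗ eqₘ =
      ·-cancelʳ (‖u-v‖≢0 c≢d) (trans (sym (collision-difference eqₗ)) (collision-difference eqₘ))

    1+t²≢0 : ∀ t → 1# + t * t ≢ 0#
    1+t²≢0 t 1+t²≡0 = 1≢0 (x²+y²≡0⇒y≡0 i²≢-1 t 1# (trans t²+1²≡1+t² 1+t²≡0))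
      where
      t²+1²≡1+t² : t * t + 1# * 1# ≡ 1# + t * t
      t²+1²≡1+t² = solve 1 (λ t → t :* t :+ con (pos 1) :* con (pos 1) := con (pos 1) :+ t :* t) refl t

    unitCircle : Carrier → Point F
    unitCircle t = ((1# + - (t * t)) * (1# + t * t) ⁻¹ , (t + t) * (1# + t * t) ⁻¹)

    ‖unitCircle‖ : ∀ t → ‖ unitCircle t ‖ ≡ 1#
    ‖unitCircle‖ t = begin
      ‖ unitCircle t ‖                    ≡⟨ solve 2 (λ t w →
          ((con (pos 1) :- t :* t) :* w) :* ((con (pos 1) :- t :* t) :* w) :+ ((t :+ t) :* w) :* ((t :+ t) :* w)
            := ((con (pos 1) :+ t :* t) :* w) :* ((con (pos 1) :+ t :* t) :* w)) refl t w ⟩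
      ((1# + t * t) * w) * ((1# + t * t) * w)  ≡⟨ cong (λ z → z * z) (⁻¹-inverse (1# + t * t) (1+t²≢0 t)) ⟩
      1# * 1#                                ≡⟨ *-identityʳ 1# ⟩
      1#                                     ∎
      where
      open ≡-Reasoning
      w = (1# + t * t) ⁻¹

    module _ (2≢0 : 1# + 1# ≢ 0#) where

      -- Stereographic projection from (−1, 0) inverts the parametrisation.
      unitCircle-slope : ∀ t → proj₂ (unitCircle t) * (1# + proj₁ (unitCircle t)) ⁻¹ ≡ t
      unitCircle-slope t = begin
        (t + t) * w * (1# + (1# + - (t * t)) * w) ⁻¹   ≡⟨ cong₂ (λ y x → y * x ⁻¹) y≡tD 1+x≡D ⟩
        t * D * D ⁻¹                                  ≡⟨ solve 3 (λ t d d⁻¹ → t :* d :* d⁻¹ := t :* (d :* d⁻¹))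
                                                             refl t D (D ⁻¹) ⟩
        t * (D * D ⁻¹)                                ≡⟨ cong (t *_) (⁻¹-inverse D D≢0) ⟩
        t * 1#                                        ≡⟨ *-identityʳ t ⟩
        t                                             ∎
        where
        open ≡-Reasoning
        u = 1# + t * t
        w = u ⁻¹
        D = (1# + 1#) * w
        uw≡1 : u * w ≡ 1#
        uw≡1 = ⁻¹-inverse u (1+t²≢0 t)
        D≢0 : D ≢ 0#
        D≢0 = *-nonZero 2≢0 (λ w≡0 → 1≢0 (trans (sym uw≡1) (trans (cong (u *_) w≡0) (zeroʳ u))))
        y≡tD : (t + t) * w ≡ t * D
        y≡tD = solve 2 (λ t w → (t :+ t) :* w := t :* ((con (pos 1) :+ con (pos 1)) :* w)) refl t w
        1+x≡D : 1# + (1# + - (t * t)) * w ≡ D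
        1+x≡D = begin
          1# + (1# + - (t * t)) * w   ≡⟨ cong (_+ (1# + - (t * t)) * w) uw≡1 ⟨
          u * w + (1# + - (t * t)) * w  ≡⟨ solve 2 (λ t w → (con (pos 1) :+ t :* t) :* w :+ (con (pos 1) :- t :* t) :* w
                                             := (con (pos 1) :+ con (pos 1)) :* w) refl t w ⟩
          D                            ∎

      unitCircle-injective : ∀ {t v} → unitCircle t ≡ unitCircle v → t ≡ v
      unitCircle-injective {t} {v} eq =
        trans (sym (unitCircle-slope t)) (trans (cong (λ p → proj₂ p * (1# + proj₁ p) ⁻¹) eq) (unitCircle-slope v))

      module _ (E : List (Point F)) (uniq-E : Unique E) {s : Carrier} (s≢0 : s ≢ 0#) where

        circle : Carrier → Point F
        circle t = s ∙ unitCircle t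

        ‖circle‖ : ∀ t → ‖ circle t ‖ ≡ s * s
        ‖circle‖ t = trans (‖∙‖ s (unitCircle t)) (trans (cong ((s * s) *_) (‖unitCircle‖ t)) (*-identityʳ (s * s)))

        circle-injective : ∀ {t v} → circle t ≡ circle v → t ≡ v
        circle-injective = unitCircle-injective ∘ ∙-cancelˡ s≢0

        private
          n q : ℕ
          n = length E
          q = size

        pairs : List (Point F × Point F)
        pairs = cartesianProduct E E

        quad : Point F × Point F → Point F × Point F → Point F × Point F × Point F × Point F
        quad (a , c) (b , d) = (a , b , c , d)

        h : Carrier → Point F × Point F → Point F
        h t (a , c) = a -ᵖ circle t · c

        properCollision? : ∀ t x y → Dec (proj₂ x ≢ proj₂ y × h t x ≡ h t y)
        properCollision? t (a , c) (b , d) = ¬? (c ≟ᵖ d) ×-dec (h t (a , c) ≟ᵖ h t (b , d))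

        good? : ∀ x y → Dec (GoodQuad F (s * s) (quad x y))
        good? x y = goodQuad? F (s * s) (quad x y)

        collisionsₜ properCollisionsₜ : Carrier → ℕ
        collisionsₜ t = collisions _≟ᵖ_ (h t) pairs
        properCollisionsₜ t = ∑[ x ∈ pairs ] ∑[ y ∈ pairs ] 𝟙 (properCollision? t x y)

        goodPairs : ℕ
        goodPairs = ∑[ x ∈ pairs ] ∑[ y ∈ pairs ] 𝟙 (good? x y)

        n⁴≤q²*collisionsₜ : ∀ t → (n ℕ.* n) ℕ.* (n ℕ.* n) ℕ.≤ (q ℕ.* q) ℕ.* collisionsₜ t
        n⁴≤q²*collisionsₜ t = subst₂ (λ p r → p ℕ.* p ℕ.≤ r ℕ.* collisionsₜ t)
          (length-cartesianProduct E E) (length-cartesianProduct elements elements)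
          (length²≤length*collisions _≟ᵖ_ (h t) (cartesianProduct elements elements) pairs
            (All.tabulate (λ _ → ∈-cartesianProduct⁺ (elements-complete _) (elements-complete _))))

        collisionsₜ≤properCollisionsₜ+n² : ∀ t → collisionsₜ t ℕ.≤ properCollisionsₜ t ℕ.+ n ℕ.* n
        collisionsₜ≤properCollisionsₜ+n² t = begin
          collisionsₜ t
            ≤⟨ ∑-mono pairs (λ {x} _ → ∑-mono pairs (λ {y} _ → split x y)) ⟩
          ∑[ x ∈ pairs ] ∑[ y ∈ pairs ] (𝟙 (properCollision? t x y) ℕ.+ 𝟙 (y ≟² x))
            ≡⟨ trans (∑-cong pairs (λ {x} _ → ∑-+ pairs _ _)) (∑-+ pairs _ _) ⟩
          properCollisionsₜ t ℕ.+ ∑[ x ∈ pairs ] ∑[ y ∈ pairs ] 𝟙 (y ≟² x)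
            ≡⟨ cong (properCollisionsₜ t ℕ.+_) diagonal ⟩
          properCollisionsₜ t ℕ.+ n ℕ.* n
            ∎
          where
          open ℕ.≤-Reasoning
          split : ∀ x y → 𝟙 (h t x ≟ᵖ h t y) ℕ.≤ 𝟙 (properCollision? t x y) ℕ.+ 𝟙 (y ≟² x)
          split x y = 𝟙-⊎ (h t x ≟ᵖ h t y) (properCollision? t x y) (y ≟² x) (cases x y)
            where
            cases : ∀ x y → h t x ≡ h t y → (proj₂ x ≢ proj₂ y × h t x ≡ h t y) ⊎ y ≡ x
            cases (a , c) (b , d) hx≡hy with c ≟ᵖ d
            ... | no c≢d = inj₁ (c≢d , hx≡hy)
            ... | yes refl = inj₂ (cong (_, c) (sym (collision-diagonal hx≡hy)))
          diagonal : ∑[ x ∈ pairs ] ∑[ y ∈ pairs ] 𝟙 (y ≟² x) ≡ n ℕ.* n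
          diagonal = begin-equality
            ∑[ x ∈ pairs ] ∑[ y ∈ pairs ] 𝟙 (y ≟² x)
              ≡⟨ ∑-cong pairs (∑𝟙[x≟y]≡1 _≟²_ (Unique.cartesianProduct⁺ uniq-E uniq-E)) ⟩
            ∑[ _ ∈ pairs ] 1  ≡⟨ length≡∑1 pairs ⟨
            length pairs      ≡⟨ length-cartesianProduct E E ⟩
            n ℕ.* n           ∎

        ∑properCollisionsₜ≤goodPairs : ∑ elements properCollisionsₜ ℕ.≤ goodPairs
        ∑properCollisionsₜ≤goodPairs = begin
          ∑[ t ∈ elements ] ∑[ x ∈ pairs ] ∑[ y ∈ pairs ] 𝟙 (properCollision? t x y)
            ≡⟨ ∑-comm elements pairs _ ⟩
          ∑[ x ∈ pairs ] ∑[ t ∈ elements ] ∑[ y ∈ pairs ] 𝟙 (properCollision? t x y)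
            ≡⟨ ∑-cong pairs (λ {x} _ → ∑-comm elements pairs _) ⟩
          ∑[ x ∈ pairs ] ∑[ y ∈ pairs ] ∑[ t ∈ elements ] 𝟙 (properCollision? t x y)
            ≤⟨ ∑-mono pairs (λ {x} _ → ∑-mono pairs (λ {y} _ → atMostOneSlope x y)) ⟩
          goodPairs
            ∎
          where
          open ℕ.≤-Reasoning
          atMostOneSlope : ∀ x y → ∑[ t ∈ elements ] 𝟙 (properCollision? t x y) ℕ.≤ 𝟙 (good? x y)
          atMostOneSlope x y = ∑𝟙≤𝟙 (λ t → properCollision? t x y) (good? x y) elements-unique
            (λ (c≢d , eqₜ) (_ , eqᵥ) → circle-injective (collision-unique c≢d eqₜ eqᵥ))
            (λ {t} (c≢d , eq) → collision⇒GoodQuad (‖circle‖ t) c≢d eq)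

        countQuads≡goodPairs : countQuads F E (s * s) ≡ goodPairs
        countQuads≡goodPairs = begin
          countQuads F E (s * s)
            ≡⟨ length-filter≡∑𝟙 (goodQuad? F (s * s)) (quadruples F E) ⟩
          ∑[ p ∈ quadruples F E ] 𝟙 (goodQuad? F (s * s) p)
            ≡⟨ ∑-cartesianProduct E _ _ ⟩
          ∑[ a ∈ E ] ∑[ p ∈ cartesianProduct E (cartesianProduct E E) ] 𝟙 (goodQuad? F (s * s) (a , p))
            ≡⟨ ∑-cong E (λ _ → trans (∑-cartesianProduct E _ _) (∑-cong E (λ _ → ∑-cartesianProduct E E _))) ⟩
          ∑[ a ∈ E ] ∑[ b ∈ E ] ∑[ c ∈ E ] ∑[ d ∈ E ] 𝟙 (good? (a , c) (b , d))
            ≡⟨ ∑-cong E (λ _ → ∑-comm E E _) ⟩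
          ∑[ a ∈ E ] ∑[ c ∈ E ] ∑[ b ∈ E ] ∑[ d ∈ E ] 𝟙 (good? (a , c) (b , d))
            ≡⟨ ∑-cong E (λ _ → ∑-cong E (λ _ → ∑-cartesianProduct E E _)) ⟨
          ∑[ a ∈ E ] ∑[ c ∈ E ] ∑[ y ∈ pairs ] 𝟙 (good? (a , c) y)
            ≡⟨ ∑-cartesianProduct E E _ ⟨
          goodPairs
            ∎
          where open ≡-Reasoning

        energy-bound : (n ℕ.* n) ℕ.* (n ℕ.* n) ℕ.≤ q ℕ.* (countQuads F E (s * s) ℕ.+ q ℕ.* (n ℕ.* n))
        energy-bound = ℕ.*-cancelˡ-≤ q {{ℕ.>-nonZero 0<size}} (begin
          q ℕ.* n⁴                                   ≡⟨ ∑-const elements n⁴ ⟨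
          ∑[ _ ∈ elements ] n⁴                       ≤⟨ ∑-mono elements (λ {t} _ → n⁴≤q²*collisionsₜ t) ⟩
          ∑[ t ∈ elements ] (q² ℕ.* collisionsₜ t)   ≡⟨ ∑-*ˡ elements q² collisionsₜ ⟩
          q² ℕ.* ∑ elements collisionsₜ              ≤⟨ ℕ.*-monoʳ-≤ q² (∑-mono elements (λ {t} _ → split t)) ⟩
          q² ℕ.* ∑[ t ∈ elements ] (properCollisionsₜ t ℕ.+ n ℕ.* n)
            ≡⟨ cong (q² ℕ.*_) (trans (∑-+ elements properCollisionsₜ _) (cong (∑ elements properCollisionsₜ ℕ.+_) (∑-const elements (n ℕ.* n)))) ⟩
          q² ℕ.* (∑ elements properCollisionsₜ ℕ.+ q ℕ.* (n ℕ.* n))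
            ≤⟨ ℕ.*-monoʳ-≤ q² (ℕ.+-monoˡ-≤ (q ℕ.* (n ℕ.* n)) ∑properCollisionsₜ≤goodPairs) ⟩
          q² ℕ.* (goodPairs ℕ.+ q ℕ.* (n ℕ.* n))
            ≡⟨ trans (cong (λ G → q² ℕ.* (G ℕ.+ q ℕ.* (n ℕ.* n))) (sym countQuads≡goodPairs)) (ℕ.*-assoc q q _) ⟩
          q ℕ.* (q ℕ.* (countQuads F E (s * s) ℕ.+ q ℕ.* (n ℕ.* n)))
            ∎)
          where
          open ℕ.≤-Reasoning
          n⁴ = (n ℕ.* n) ℕ.* (n ℕ.* n)
          q² = q ℕ.* q
          split = collisionsₜ≤properCollisionsₜ+n²

  0<countQuads⇒∈Δ/Δ : ∀ E r → 0 ℕ.< countQuads F E r → InDistanceQuotient F E r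
  0<countQuads⇒∈Δ/Δ E r 0<count
    with (a , b , c , d) , abcd∈E⁴ , abcd-good ← find (filter-some⁻ (goodQuad? F r) (quadruples F E) 0<count) =
    let a∈E , bcd∈E³ = ∈-cartesianProduct⁻ E _ abcd∈E⁴
        b∈E , cd∈E² = ∈-cartesianProduct⁻ E _ bcd∈E³
        c∈E , d∈E = ∈-cartesianProduct⁻ E E cd∈E²
    in a , b , c , d , a∈E , b∈E , c∈E , d∈E , abcd-good

  module _ (q≡3[4] : size % 4 ≡ 3) where

    2∤q : ¬ 2 ∣ size
    2∤q 2∣q = ℕ.1+n≢0 (begin
      1                ≡⟨ cong (_% 2) q≡3[4] ⟨
      size % 4 % 2     ≡⟨ m∣n⇒o%n%m≡o%m 2 4 size (divides 2 refl) ⟩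
      size % 2         ≡⟨ n∣m⇒m%n≡0 size 2 2∣q ⟩
      0                ∎)
      where open ≡-Reasoning

    4∤q-1 : ¬ 4 ∣ pred size
    4∤q-1 4∣q-1 = contradiction (begin
      1                     ≡⟨ %-remove-+ʳ 1 4∣q-1 ⟨
      (1 ℕ.+ pred size) % 4  ≡⟨ cong (_% 4) (ℕ.suc-pred size {{ℕ.>-nonZero 0<size}}) ⟩
      size % 4              ≡⟨ q≡3[4] ⟩
      3                     ∎) λ ()
      where open ≡-Reasoning

    2≢0 : 1# + 1# ≢ 0#
    2≢0 = 2∤q ∘ 1+1≡0⇒2∣q

    i²≢-1 : ∀ i → i * i ≢ - 1#
    i²≢-1 i = 4∤q-1 ∘ 4∣q-1 2≢0

    module _ (E : List (Point F)) (uniq-E : Unique E) (2q≤|E| : 2 ℕ.* size ℕ.≤ length E) where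

      2≤|E| : 2 ℕ.≤ length E
      2≤|E| = ℕ.≤-trans (ℕ.*-monoʳ-≤ 2 0<size) 2q≤|E|

      countQuads-lowerBound : ∀ r → r ≢ 0# → IsSquare F r → length E ℕ.^ 4 ℕ.≤ 2 ℕ.* size ℕ.* countQuads F E r
      countQuads-lowerBound r r≢0 (s , refl) =
        n⁴≤q[G+qn²]⇒n⁴≤2qG (length E) size (countQuads F E (s * s)) 2q≤|E| (energy-bound i²≢-1 2≢0 E uniq-E s≢0)
        where
        s≢0 : s ≢ 0#
        s≢0 s≡0 = r≢0 (trans (cong (λ z → z * z) s≡0) (zeroʳ 0#))

      0<countQuads : ∀ r → r ≢ 0# → IsSquare F r → 0 ℕ.< countQuads F E r
      0<countQuads r r≢0 r-square = ℕ.n≢0⇒n>0 λ count≡0 → ℕ.<⇒≱ 0<|E|⁴ (begin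
        length E ℕ.^ 4                   ≤⟨ countQuads-lowerBound r r≢0 r-square ⟩
        2 ℕ.* size ℕ.* countQuads F E r  ≡⟨ cong (2 ℕ.* size ℕ.*_) count≡0 ⟩
        2 ℕ.* size ℕ.* 0                 ≡⟨ ℕ.*-zeroʳ (2 ℕ.* size) ⟩
        0                                ∎)
        where
        open ℕ.≤-Reasoning
        0<|E|⁴ : 0 ℕ.< length E ℕ.^ 4
        0<|E|⁴ = ℕ.m^n>0 (length E) {{ℕ.>-nonZero (ℕ.<-≤-trans (ℕ.s≤s ℕ.z≤n) 2≤|E|)}} 4

      0∈Δ/Δ : InDistanceQuotient F E 0#
      0∈Δ/Δ with a , b , a∈E , b∈E , a≢b ← distinct-pair uniq-E 2≤|E| =
        a , a , a , b , a∈E , a∈E , a∈E , b∈E , ‖u-v‖≢0 i²≢-1 a≢b , (begin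
          ‖ a -ᵖ a ‖ * ‖ a -ᵖ b ‖ ⁻¹   ≡⟨ cong (λ u → ‖ u ‖ * ‖ a -ᵖ b ‖ ⁻¹) (u-ᵖu≡0ᵖ a) ⟩
          ‖ 0ᵖ ‖ * ‖ a -ᵖ b ‖ ⁻¹       ≡⟨ solve 1 (λ x → (con (pos 0) :* con (pos 0) :+ con (pos 0) :* con (pos 0)) :* x
                                                     := con (pos 0)) refl (‖ a -ᵖ b ‖ ⁻¹) ⟩
          0#                         ∎)
        where open ≡-Reasoning

      squares⊆Δ/Δ : ∀ r → IsSquare F r → InDistanceQuotient F E r
      squares⊆Δ/Δ r r-square with r ≟ 0#
      ... | yes refl = 0∈Δ/Δ
      ... | no r≢0 = 0<countQuads⇒∈Δ/Δ E r (0<countQuads r r≢0 r-square)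

-- Imported only here: unqualified, these would clash with the operations of FiniteField above.
open import Data.Nat using (_*_; _^_; _≤_; _<_)

theorem1p2 :
    ∃[ C ] ∃[ N ] (0 < C × 0 < N ×
      ((F : FiniteField) → IsPrimePower (FiniteField.size F) →
       FiniteField.size F % 4 ≡ 3 →
       (E : List (Point F)) → Unique E →
       C * FiniteField.size F ≤ length E →
       ((r : FiniteField.Carrier F) → r ≢ FiniteField.0# F → IsSquare F r →
          length E ^ 4 ≤ N * FiniteField.size F * countQuads F E r)
       × ((r : FiniteField.Carrier F) → IsSquare F r → InDistanceQuotient F E r)))
theorem1p2 = 2 , 2 , ℕ.s≤s ℕ.z≤n , ℕ.s≤s ℕ.z≤n , λ F _ q≡3[4] E uniq-E 2q≤|E| →
  countQuads-lowerBound F q≡3[4] E uniq-E 2q≤|E| , squares⊆Δ/Δ F q≡3[4] E uniq-E 2q≤|E|
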